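{- Let $T$ be a tree with $n$ vertices. Then $\mathcal{TE}_+(T)\cong K_n$ and $\mathcal{TS}_+(T)\cong T$.
   Context: PSD (positive semidefinite) forcing on a graph $G$: vertices are blue or white; starting from an initial blue set $B$, repeatedly apply the rule: if $C$ is a connected component of the graph obtained from $G$ by deleting the currently blue vertices, and $u$ is a blue vertex with $N_G(u)\cap V(C)=\{w\}$, then $w$ becomes blue. $B$ is a PSD forcing set if eventually all vertices are blue; $\mathrm{Z}_+(G)$ is the minimum size of a PSD forcing set. $\mathcal{TE}_+(G)$ (token exchange graph) has as vertices the PSD forcing sets of size $\mathrm{Z}_+(G)$, with $S_1S_2$ an edge iff there are $v_1\in S_1\setminus S_2$, $v_2\in S_2\setminus S_1$ with $S_1\setminus\{v_1\}=S_2\setminus\{v_2\}$; $\mathcal{TS}_+(G)$ (token sliding graph) has the same vertices, with $S_1S_2$ an edge iff additionally $v_1v_2\in E(G)$. -}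

module Defs where

open import Data.Nat using (ℕ; suc; _≤_; _+_)
open import Data.Fin using (Fin; zero; suc; fromℕ; inject₁)
open import Data.Fin.Subset using (Subset; _∈_; _∉_; ∣_∣; ⁅_⁆; _∪_; _-_; ⊤)
open import Data.Product using (Σ; ∃; _×_; _,_)
open import Relation.Binary.PropositionalEquality using (_≡_; _≢_)
open import Relation.Nullary using (¬_)
open import Function.Definitions using (Injective)
open import Function.Bundles using (_⇔_)

record Graph (n : ℕ) : Set₁ where
  field
    Adj   : Fin n → Fin n → Set
    sym   : ∀ {x y} → Adj x y → Adj y x
    irrefl : ∀ {x} → ¬ Adj x x
open Graph public

K : (n : ℕ) → Graph n
K n = record { Adj = λ i j → i ≢ j ; sym = λ p q → p (Data-sym q) ; irrefl = λ p → p Relation.Binary.PropositionalEquality.refl }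
  where
  Data-sym = Relation.Binary.PropositionalEquality.sym

data WalkIn {n : ℕ} (G : Graph n) (P : Fin n → Set) : Fin n → Fin n → Set where
  here  : ∀ {x} → P x → WalkIn G P x x
  there : ∀ {x y z} → P x → Adj G x y → WalkIn G P y z → WalkIn G P x z

Connected : {n : ℕ} → Graph n → Set
Connected G = ∀ x y → WalkIn G (λ _ → Data.Unit.⊤) x y
  where import Data.Unit

record Cycle {n : ℕ} (G : Graph n) : Set where
  field
    k      : ℕ
    c      : Fin (suc (suc (suc k))) → Fin n
    c-inj  : Injective _≡_ _≡_ c
    c-step : ∀ (i : Fin (suc (suc k))) → Adj G (c (inject₁ i)) (c (suc i))
    c-close : Adj G (c (fromℕ (suc (suc k)))) (c zero)

record IsTree {n : ℕ} (G : Graph n) : Set where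
  field
    nonempty  : Fin n
    connected : Connected G
    acyclic   : ¬ Cycle G

SameWhiteComponent : {n : ℕ} → Graph n → Subset n → Fin n → Fin n → Set
SameWhiteComponent G B x y = WalkIn G (λ v → v ∉ B) x y

-- PSD force: blue u forces white w when w is the unique neighbour of u
-- in the component C of G − B containing w.
PSDForce : {n : ℕ} → Graph n → Subset n → Fin n → Fin n → Set
PSDForce G B u w =
  u ∈ B × w ∉ B × Adj G u w ×
  (∀ x → x ∉ B → SameWhiteComponent G B w x → Adj G u x → x ≡ w)

data PSDReach {n : ℕ} (G : Graph n) : Subset n → Subset n → Set where
  done  : ∀ {B} → PSDReach G B B
  step  : ∀ {B B′} u w → PSDForce G B u w → PSDReach G (B ∪ ⁅ w ⁆) B′ → PSDReach G B B′

PSDForcingSet : {n : ℕ} → Graph n → Subset n → Set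
PSDForcingSet G B = PSDReach G B ⊤

IsZPlus : {n : ℕ} → Graph n → ℕ → Set
IsZPlus G k = (Σ _ λ B → PSDForcingSet G B × ∣ B ∣ ≡ k) × (∀ B → PSDForcingSet G B → k ≤ ∣ B ∣)

-- Vertices of TE₊(G)/TS₊(G) given k = Z₊(G): PSD forcing sets of size k.
MinPSDForcingSet : {n : ℕ} → Graph n → ℕ → Subset n → Set
MinPSDForcingSet G k S = PSDForcingSet G S × ∣ S ∣ ≡ k

TEAdj : {n : ℕ} → Subset n → Subset n → Set
TEAdj S₁ S₂ = Σ _ λ v₁ → Σ _ λ v₂ →
  v₁ ∈ S₁ × v₁ ∉ S₂ × v₂ ∈ S₂ × v₂ ∉ S₁ × S₁ - v₁ ≡ S₂ - v₂

TSAdj : {n : ℕ} → Graph n → Subset n → Subset n → Set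
TSAdj G S₁ S₂ = Σ _ λ v₁ → Σ _ λ v₂ →
  v₁ ∈ S₁ × v₁ ∉ S₂ × v₂ ∈ S₂ × v₂ ∉ S₁ × S₁ - v₁ ≡ S₂ - v₂ × Adj G v₁ v₂

-- Graph isomorphism between a graph H on Fin m and the graph whose vertex set is
-- { S : Subset n | P S } with adjacency E.
record IsoToSetGraph {m n : ℕ} (H : Graph m) (P : Subset n → Set)
                     (E : Subset n → Subset n → Set) : Set where
  field
    φ      : Fin m → Subset n
    φ-in   : ∀ i → P (φ i)
    φ-onto : ∀ S → P S → ∃ λ i → φ i ≡ S
    φ-inj  : Injective _≡_ _≡_ φ
    φ-adj  : ∀ i j → Adj H i j ⇔ E (φ i) (φ j)

{-# OPTIONS --safe #-}
-- In an acyclic graph a blue vertex u forces every white neighbour w: a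
-- second white neighbour of u in the component of w would close a cycle
-- through u.  In a connected graph some blue vertex has a white neighbour as
-- long as a white vertex is left, so in a tree every nonempty set, in
-- particular every singleton, is a PSD forcing set, and Z₊(T) = 1.  The
-- minimum forcing sets are therefore exactly the singletons ⁅ v ⁆; two distinct
-- singletons differ by one token exchange, and a token slides from v to w
-- exactly when vw is an edge.
module Submission where

open import Defs hiding (sym)
open import Data.Nat using (ℕ; zero; suc; pred; _≤_; s≤s)
open import Data.Fin using (Fin; zero; suc; fromℕ; inject₁; _≟_)
open import Data.Fin.Properties using (any?)
open import Data.Fin.Subset
  using (Subset; _∈_; _∉_; ∣_∣; ⁅_⁆; _∪_; _-_; ⊥; ∁; _⊂_; _⊃_; Nonempty; inside; outside)
open import Data.Fin.Subset.Properties
  using ( _∈?_; nonempty?; ∈⊤; ⊆⊤; ∉⊥; ⊆-antisym; p⊆p∪q; q⊆p∪q; x∈⁅x⁆; x∈⁅y⁆⇒x≡y; x≢y⇒x∉⁅y⁆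
        ; ∣⁅x⁆∣≡1; p─⊥≡p; x∈∁p⇒x∉p; x∉∁p⇒x∈p)
open import Data.Fin.Subset.Induction using (Acc; acc; ⊃-wellFounded)
open import Data.Vec using (_∷_; [])
open import Data.Product using (Σ; ∃; ∃₂; _×_; _,_)
open import Data.Empty using (⊥-elim)
open import Data.Unit using (tt) renaming (⊤ to Unit)
open import Function.Base using (_∘_)
open import Function.Bundles using (_⇔_; mk⇔)
open import Function.Definitions using (Injective)
open import Relation.Nullary using (¬_; yes; no)
open import Relation.Binary.PropositionalEquality using (_≡_; _≢_; refl; sym; trans; cong; subst; subst₂)

module _ {n : ℕ} {G : Graph n} {P : Fin n → Set} where

  length : ∀ {x z} → WalkIn G P x z → ℕ
  length (here _)      = 0
  length (there _ _ r) = suc (length r)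

  vertex : ∀ {x z} (r : WalkIn G P x z) → Fin (suc (length r)) → Fin n
  vertex (here {x} _)      zero    = x
  vertex (there {x} _ _ _) zero    = x
  vertex (there _ _ r)     (suc i) = vertex r i

  vertex-zero : ∀ {x z} (r : WalkIn G P x z) → vertex r zero ≡ x
  vertex-zero (here _)      = refl
  vertex-zero (there _ _ _) = refl

  vertex-last : ∀ {x z} (r : WalkIn G P x z) → vertex r (fromℕ (length r)) ≡ z
  vertex-last (here _)      = refl
  vertex-last (there _ _ r) = vertex-last r

  vertex-P : ∀ {x z} (r : WalkIn G P x z) i → P (vertex r i)
  vertex-P (here p)      zero    = p
  vertex-P (there p _ _) zero    = p
  vertex-P (there _ _ r) (suc i) = vertex-P r i

  vertex-adjacent : ∀ {x z} (r : WalkIn G P x z) (i : Fin (length r)) →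
                    Adj G (vertex r (inject₁ i)) (vertex r (suc i))
  vertex-adjacent (there {x} _ xy r) zero    = subst (Adj G x) (sym (vertex-zero r)) xy
  vertex-adjacent (there _ _ r)      (suc i) = vertex-adjacent r i

  IsPath : ∀ {x z} → WalkIn G P x z → Set
  IsPath (here _)          = Unit
  IsPath (there {x} _ _ r) = (∀ i → vertex r i ≢ x) × IsPath r

  Path : Fin n → Fin n → Set
  Path x z = Σ (WalkIn G P x z) IsPath

  vertex-injective : ∀ {x z} (r : WalkIn G P x z) → IsPath r → Injective _≡_ _≡_ (vertex r)
  vertex-injective (here _)      _         {zero}  {zero}  _ = refl
  vertex-injective (there _ _ r) _         {zero}  {zero}  _ = refl
  vertex-injective (there _ _ r) (new , _) {zero}  {suc j} e = ⊥-elim (new j (sym e))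
  vertex-injective (there _ _ r) (new , _) {suc i} {zero}  e = ⊥-elim (new i e)
  vertex-injective (there _ _ r) (_ , p)    {suc i} {suc j} e = cong suc (vertex-injective r p e)

  suffix : ∀ {x z} (r : WalkIn G P x z) → IsPath r → (i : Fin (suc (length r))) → Path (vertex r i) z
  suffix (here p)      _       zero    = here p , tt
  suffix (there p a r) path    zero    = there p a r , path
  suffix (there _ _ r) (_ , p) (suc i) = suffix r p i

  walk⇒path : ∀ {x z} → WalkIn G P x z → Path x z
  walk⇒path (here p) = here p , tt
  walk⇒path {x} {z} (there px xy r) with walk⇒path r
  ... | r′ , p′ with any? (λ i → vertex r′ i ≟ x)
  ...   | yes (i , revisit) = subst (λ s → Path s z) revisit (suffix r′ p′ i)
  ...   | no  fresh         = there px xy r′ , (λ i e → fresh (i , e)) , p′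

  path⇒cycle : ∀ {u w x} → ¬ P u → Adj G u w → Adj G x u → w ≢ x → Path w x → Cycle G
  path⇒cycle _ _ _ w≢x (here _ , _) = ⊥-elim (w≢x refl)
  path⇒cycle {u} ¬Pu uw xu _ (r@(there _ _ r′) , path) = record
    { k       = length r′
    ; c       = c
    ; c-inj   = c-injective
    ; c-step  = c-step
    ; c-close = subst (λ s → Adj G s u) (sym (vertex-last r)) xu
    }
    where
    c : Fin (suc (suc (suc (length r′)))) → Fin n
    c zero    = u
    c (suc i) = vertex r i

    c-injective : Injective _≡_ _≡_ c
    c-injective {zero}  {zero}  _ = refl
    c-injective {zero}  {suc j} e = ⊥-elim (¬Pu (subst P (sym e) (vertex-P r j)))
    c-injective {suc i} {zero}  e = ⊥-elim (¬Pu (subst P e (vertex-P r i)))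
    c-injective {suc i} {suc j} e = cong suc (vertex-injective r path e)

    c-step : ∀ (i : Fin (suc (suc (length r′)))) → Adj G (c (inject₁ i)) (c (suc i))
    c-step zero    = uw
    c-step (suc i) = vertex-adjacent r i

  acyclic⇒neighbour-unique : ∀ {u w x} → ¬ Cycle G → ¬ P u →
                             Adj G u w → Adj G u x → WalkIn G P w x → w ≡ x
  acyclic⇒neighbour-unique {w = w} {x} acyclic ¬Pu uw ux r with w ≟ x
  ... | yes w≡x = w≡x
  ... | no  w≢x = ⊥-elim (acyclic (path⇒cycle ¬Pu uw (Graph.sym G ux) w≢x (walk⇒path r)))

  crossingEdge : ∀ {B v y} → WalkIn G P v y → v ∈ B → y ∉ B →
                 ∃₂ λ u w → u ∈ B × w ∉ B × Adj G u w
  crossingEdge (here _) v∈B y∉B = ⊥-elim (y∉B v∈B)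
  crossingEdge {B} {v} (there {y = v′} _ vv′ r) v∈B y∉B with v′ ∈? B
  ... | yes v′∈B = crossingEdge r v′∈B y∉B
  ... | no  v′∉B = v , v′ , v∈B , v′∉B , vv′

module _ {n : ℕ} {G : Graph n} where

  acyclic⇒PSDForce : ∀ {B u w} → ¬ Cycle G → u ∈ B → w ∉ B → Adj G u w → PSDForce G B u w
  acyclic⇒PSDForce acyclic u∈B w∉B uw =
    u∈B , w∉B , uw , λ x _ w~x ux → sym (acyclic⇒neighbour-unique acyclic (λ u∉B → u∉B u∈B) uw ux w~x)

  forcingSet-nonempty : ∀ {B} → Fin n → PSDForcingSet G B → Nonempty B
  forcingSet-nonempty x done                   = x , ∈⊤
  forcingSet-nonempty _ (step u _ (u∈B , _) _) = u , u∈B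

  nonempty⇒forcingSet : Connected G → ¬ Cycle G → ∀ {B} → Nonempty B → PSDForcingSet G B
  nonempty⇒forcingSet connected acyclic {B} nonempty = go B nonempty (⊃-wellFounded B)
    where
    go : ∀ B → Nonempty B → Acc _⊃_ B → PSDForcingSet G B
    go B (v , v∈B) (acc larger) with nonempty? (∁ B)
    ... | no allBlue = subst (PSDReach G B) (⊆-antisym ⊆⊤ λ {y} _ → x∉∁p⇒x∈p λ y∈∁B → allBlue (y , y∈∁B)) done
    ... | yes (y , y∈∁B) with crossingEdge (connected v y) v∈B (x∈∁p⇒x∉p y∈∁B)
    ...   | u , w , u∈B , w∉B , uw =
      step u w (acyclic⇒PSDForce acyclic u∈B w∉B uw) (go (B ∪ ⁅ w ⁆) (v , p⊆p∪q ⁅ w ⁆ v∈B) (larger B⊂B∪w))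
      where
      B⊂B∪w : B ⊂ B ∪ ⁅ w ⁆
      B⊂B∪w = p⊆p∪q ⁅ w ⁆ , w , q⊆p∪q B ⁅ w ⁆ (x∈⁅x⁆ w) , w∉B

∣p∣≡0⇒p≡⊥ : ∀ {n} (p : Subset n) → ∣ p ∣ ≡ 0 → p ≡ ⊥
∣p∣≡0⇒p≡⊥ []            _ = refl
∣p∣≡0⇒p≡⊥ (outside ∷ p) e = cong (outside ∷_) (∣p∣≡0⇒p≡⊥ p e)

∣p∣≡1⇒p≡⁅x⁆ : ∀ {n} (p : Subset n) → ∣ p ∣ ≡ 1 → ∃ λ x → ⁅ x ⁆ ≡ p
∣p∣≡1⇒p≡⁅x⁆ (inside ∷ p)  e = zero , cong (inside ∷_) (sym (∣p∣≡0⇒p≡⊥ p (cong pred e)))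
∣p∣≡1⇒p≡⁅x⁆ (outside ∷ p) e with ∣p∣≡1⇒p≡⁅x⁆ p e
... | x , ⁅x⁆≡p = suc x , cong (outside ∷_) ⁅x⁆≡p

⁅x⁆-x≡⊥ : ∀ {n} (x : Fin n) → ⁅ x ⁆ - x ≡ ⊥
⁅x⁆-x≡⊥ zero    = cong (outside ∷_) (p─⊥≡p ⊥)
⁅x⁆-x≡⊥ (suc x) = cong (outside ∷_) (⁅x⁆-x≡⊥ x)

singletons-iso : ∀ {n} {H : Graph n} {P : Subset n → Set} {E : Subset n → Subset n → Set} →
                 (∀ x → P ⁅ x ⁆) → (∀ S → P S → ∃ λ x → ⁅ x ⁆ ≡ S) →
                 (∀ x y → Adj H x y ⇔ E ⁅ x ⁆ ⁅ y ⁆) → IsoToSetGraph H P E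
singletons-iso P⁅x⁆ P⇒singleton adj = record
  { φ      = ⁅_⁆
  ; φ-in   = P⁅x⁆
  ; φ-onto = P⇒singleton
  ; φ-inj  = λ {x} {y} e → x∈⁅y⁆⇒x≡y y (subst (x ∈_) e (x∈⁅x⁆ x))
  ; φ-adj  = adj
  }

⁅x⁆-x≡⁅y⁆-y : ∀ {n} (x y : Fin n) → ⁅ x ⁆ - x ≡ ⁅ y ⁆ - y
⁅x⁆-x≡⁅y⁆-y x y = trans (⁅x⁆-x≡⊥ x) (sym (⁅x⁆-x≡⊥ y))

TEAdj-⁅⁆ : ∀ {n} (x y : Fin n) → x ≢ y ⇔ TEAdj ⁅ x ⁆ ⁅ y ⁆
TEAdj-⁅⁆ x y = mk⇔
  (λ x≢y → x , y , x∈⁅x⁆ x , x≢y⇒x∉⁅y⁆ x≢y , x∈⁅x⁆ y , x≢y⇒x∉⁅y⁆ (x≢y ∘ sym) , ⁅x⁆-x≡⁅y⁆-y x y)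
  (λ { (v , _ , v∈⁅x⁆ , v∉⁅y⁆ , _) x≡y → v∉⁅y⁆ (subst (λ t → v ∈ ⁅ t ⁆) x≡y v∈⁅x⁆) })

TSAdj-⁅⁆ : ∀ {n} (G : Graph n) (x y : Fin n) → Adj G x y ⇔ TSAdj G ⁅ x ⁆ ⁅ y ⁆
TSAdj-⁅⁆ G x y = mk⇔
  (λ xy → let x≢y = adjacent⇒distinct xy in
    x , y , x∈⁅x⁆ x , x≢y⇒x∉⁅y⁆ x≢y , x∈⁅x⁆ y , x≢y⇒x∉⁅y⁆ (x≢y ∘ sym) , ⁅x⁆-x≡⁅y⁆-y x y , xy)
  (λ { (v , w , v∈⁅x⁆ , _ , w∈⁅y⁆ , _ , _ , vw) → subst₂ (Adj G) (x∈⁅y⁆⇒x≡y x v∈⁅x⁆) (x∈⁅y⁆⇒x≡y y w∈⁅y⁆) vw })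
  where
  adjacent⇒distinct : Adj G x y → x ≢ y
  adjacent⇒distinct xy refl = Graph.irrefl G xy

module _ {n : ℕ} {T : Graph n} (tree : IsTree T) where
  open IsTree tree

  ⁅x⁆-forcingSet : ∀ x → PSDForcingSet T ⁅ x ⁆
  ⁅x⁆-forcingSet x = nonempty⇒forcingSet connected acyclic (x , x∈⁅x⁆ x)

  Z₊≡1 : ∀ {k} → IsZPlus T k → k ≡ 1
  Z₊≡1 {zero} ((B , forcing , ∣B∣≡0) , _)
    with ∣p∣≡0⇒p≡⊥ B ∣B∣≡0 | forcingSet-nonempty nonempty forcing
  ... | refl | _ , x∈⊥ = ⊥-elim (∉⊥ x∈⊥)
  Z₊≡1 {suc zero} _ = refl
  Z₊≡1 {suc (suc k)} (_ , minimal)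
    with subst (suc (suc k) ≤_) (∣⁅x⁆∣≡1 nonempty) (minimal ⁅ nonempty ⁆ (⁅x⁆-forcingSet nonempty))
  ... | s≤s ()

mainTheorem7 : (n : ℕ) (T : Graph n) → IsTree T → (k : ℕ) → IsZPlus T k →
    IsoToSetGraph (K n) (MinPSDForcingSet T k) TEAdj ×
    IsoToSetGraph T (MinPSDForcingSet T k) (TSAdj T)
mainTheorem7 n T tree k Z₊≡k rewrite Z₊≡1 tree Z₊≡k =
  singletons-iso ⁅x⁆-minimum minimum⇒singleton TEAdj-⁅⁆ ,
  singletons-iso ⁅x⁆-minimum minimum⇒singleton (TSAdj-⁅⁆ T)
  where
  ⁅x⁆-minimum : ∀ x → MinPSDForcingSet T 1 ⁅ x ⁆
  ⁅x⁆-minimum x = ⁅x⁆-forcingSet tree x , ∣⁅x⁆∣≡1 x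

  minimum⇒singleton : ∀ S → MinPSDForcingSet T 1 S → ∃ λ x → ⁅ x ⁆ ≡ S
  minimum⇒singleton S (_ , ∣S∣≡1) = ∣p∣≡1⇒p≡⁅x⁆ S ∣S∣≡1
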